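{- Let $\Delta\ge 3$ be an integer and $0<\epsilon\le 1/\Delta^5$ a real number, and let $n$ be sufficiently large in terms of $\Delta$ and $\epsilon$. Let $G_n$ be a graph on $n$ vertices with $\Delta(G_n)\le\Delta$, let $k=\chi(G_n)$, $\sigma=\sigma(G_n)$, and $N=(k-1)n+\sigma+\lceil \Delta^4\epsilon n\rceil$. Consider any red-blue edge-coloring of $K_N$ on vertex set $V$ with red graph $R$ and blue graph $B$. Let $C^{(1)},C^{(2)},\dots$ be ordered disjoint longest cycles in $R$ with lengths $c_1,c_2,\dots$, let $r$ be the largest integer with $c_r\ge\epsilon^2 n$, and let $W=V\setminus\bigcup_{j=1}^r V(C^{(j)})$. If $w_1,\dots,w_\Delta$ are vertices of $W$, then for each $1\le i\le r$ the common blue-neighborhood $\bigcap_{j=1}^{\Delta}N_B(w_j)$ contains at least $\frac12(c_i-\Delta^2)$ vertices of $C^{(i)}$.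
   Context: $\chi(G)$ is the chromatic number and $\sigma(G)$ is the minimum size of a color class over all proper vertex-colorings of $G$ with $\chi(G)$ colors. Cycles $C^{(1)},C^{(2)},\dots$ are called ordered disjoint longest cycles in $R$ if, for each $i$, $C^{(i)}$ is a longest cycle in the graph $R\setminus\bigcup_{j<i}V(C^{(j)})$. $N_B(w)$ is the set of vertices joined to $w$ by a blue edge.
   Formalization: The parameter ε is a rational number rather than a real number, still subject to 0 < ε ≤ 1/Δ⁵. -}

module Defs where

open import Data.Nat as ℕ using (ℕ; zero; suc; _+_; _*_; _∸_; _^_; _≤_; _<_)
open import Data.Integer as ℤ using (ℤ; +_)
open import Data.Rational as ℚ using (ℚ)
open import Data.Bool using (Bool; true; false)
open import Data.Fin using (Fin)
open import Data.Fin.Subset using (Subset; ∣_∣)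
open import Data.Vec using (tabulate)
open import Data.List using (List; []; _∷_; _++_; length; concat; take; lookup)
open import Data.List.Relation.Unary.All using (All)
open import Data.List.Relation.Unary.Unique.Propositional using (Unique)
open import Data.List.Relation.Unary.Linked using (Linked)
open import Data.List.Membership.Propositional using (_∈_; _∉_)
open import Data.List.Relation.Binary.Subset.Propositional using (_⊆_)
open import Data.Product using (Σ; ∃; ∃-syntax; _×_)
open import Data.Sum using (_⊎_)
open import Data.Empty using (⊥)
open import Relation.Nullary using (¬_)
open import Relation.Binary.PropositionalEquality using (_≡_; _≢_)
open import Relation.Nullary.Decidable using (⌊_⌋)

record SimpleGraph (n : ℕ) : Set where
  field
    adj   : Fin n → Fin n → Bool
    sym   : ∀ u v → adj u v ≡ adj v u
    irrefl : ∀ v → adj v v ≡ false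

open SimpleGraph public

nbhd : ∀ {n} → SimpleGraph n → Fin n → Subset n
nbhd G v = tabulate (adj G v)

degree : ∀ {n} → SimpleGraph n → Fin n → ℕ
degree G v = ∣ nbhd G v ∣

MaxDegree≤ : ∀ {n} → SimpleGraph n → ℕ → Set
MaxDegree≤ G Δ = ∀ v → degree G v ≤ Δ

ProperColouring : ∀ {n} → SimpleGraph n → (k : ℕ) → (Fin n → Fin k) → Set
ProperColouring G k c = ∀ u v → adj G u v ≡ true → c u ≢ c v

Colourable : ∀ {n} → SimpleGraph n → ℕ → Set
Colourable G k = ∃[ c ] ProperColouring G k c

IsChromaticNumber : ∀ {n} → SimpleGraph n → ℕ → Set
IsChromaticNumber G k = Colourable G k × (∀ m → m < k → ¬ Colourable G m)

classSize : ∀ {n k} → (Fin n → Fin k) → Fin k → ℕ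
classSize {k = k} c i = ∣ tabulate (λ u → ⌊ c u Data.Fin.≟ i ⌋) ∣

IsSigma : ∀ {n} → SimpleGraph n → (k s : ℕ) → Set
IsSigma G k s =
  (∃[ c ] ProperColouring G k c × ∃[ i ] classSize c i ≡ s)
  × (∀ c → ProperColouring G k c → ∀ i → s ≤ classSize c i)

-- Red/blue edge colourings of K_N on vertex set Fin N.
-- red u v ≡ true means the edge uv is red, false means blue
-- (the diagonal value is irrelevant).

RedBlue : ℕ → Set
RedBlue N = Fin N → Fin N → Bool

SymmetricColouring : ∀ {N} → RedBlue N → Set
SymmetricColouring col = ∀ u v → col u v ≡ col v u

RedAdj : ∀ {N} → RedBlue N → Fin N → Fin N → Set
RedAdj col u v = u ≢ v × col u v ≡ true

BlueAdj : ∀ {N} → RedBlue N → Fin N → Fin N → Set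
BlueAdj col u v = u ≢ v × col u v ≡ false

IsCycle : ∀ {A : Set} → (A → A → Set) → List A → Set
IsCycle E [] = ⊥
IsCycle E (x ∷ xs) =
  3 ≤ length (x ∷ xs) × Unique (x ∷ xs) × Linked E (x ∷ xs ++ x ∷ [])

RedCycleAvoiding : ∀ {N} → RedBlue N → List (Fin N) → List (Fin N) → Set
RedCycleAvoiding col S C = IsCycle (RedAdj col) C × All (_∉ S) C

LongestRedCycleAvoiding : ∀ {N} → RedBlue N → List (Fin N) → List (Fin N) → Set
LongestRedCycleAvoiding col S C =
  RedCycleAvoiding col S C
  × (∀ D → RedCycleAvoiding col S D → length D ≤ length C)

OrderedDisjointLongest : ∀ {N} → RedBlue N → List (List (Fin N)) → Set
OrderedDisjointLongest {N} col Cs = go [] Cs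
  where
  go : List (Fin N) → List (List (Fin N)) → Set
  go S [] = ¬ (∃[ D ] RedCycleAvoiding col S D)
  go S (C ∷ Cs′) = LongestRedCycleAvoiding col S C × go (S ++ C) Cs′

ℕ→ℚ : ℕ → ℚ
ℕ→ℚ m = + m ℚ./ 1

-- ⌈ q ⌉ for a rational q (used only for q ≥ 0), as a natural number
⌈_⌉ℕ : ℚ → ℕ
⌈ q ⌉ℕ = ℤ.∣ ℚ.⌈ q ⌉ ∣

-- Indices are 1-based in the paper; Fin index i corresponds to C⁽ⁱ⁺¹⁾.
IsLargestIndexAbove : ∀ {N} → ℚ → List (List (Fin N)) → ℕ → Set
IsLargestIndexAbove t Cs r =
  r ≤ length Cs
  × (∀ (i : Fin (length Cs)) → suc (Data.Fin.toℕ i) ≡ r → t ℚ.≤ ℕ→ℚ (length (lookup Cs i)))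
  × (∀ (i : Fin (length Cs)) → r < suc (Data.Fin.toℕ i) → ¬ (t ℚ.≤ ℕ→ℚ (length (lookup Cs i))))

{-# OPTIONS --safe #-}

-- C = C⁽ⁱ⁾ is a longest red cycle avoiding the earlier cycles, and the w_j avoid both, so no
-- red cycle uses all of V(C) together with some of the w_j. Call a vertex of C hit if some
-- w_j sends it a red edge; the unhit vertices are the blue common neighbours. Take an edge ab
-- of C (in cyclic order) with w_j red to a and w_j′ red to b. If w_j = w_j′, then w_j could be
-- inserted between a and b; if a second such edge a′b′ existed, then
--   b ⋯ a′ w_j a ⋯ b′ w_j′ b   (the second arc traversed backwards)
-- would be a longer red cycle. So at most Δ² edges have both ends hit, and counting hit ends
-- over the |C| edges gives 2·#hit ≤ |C| + Δ², i.e. |C| − Δ² ≤ 2·#unhit.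

module Submission where

open import Defs
open import Data.Nat using (ℕ; _+_; _*_; _∸_; _^_; _≤_; _<_)
open import Data.Rational as ℚ using (ℚ; 0ℚ; 1ℚ)
open import Data.Fin using (Fin; toℕ)
open import Data.List using (List; length; lookup; concat; take)
open import Data.List.Membership.Propositional using (_∈_; _∉_)
open import Data.List.Relation.Binary.Subset.Propositional using (_⊆_)
open import Data.List.Relation.Unary.All using (All)
open import Data.List.Relation.Unary.Unique.Propositional using (Unique)
open import Data.Product using (∃; ∃-syntax; _×_)

open import Data.Nat using (suc; z≤n; s≤s; s<s)
open import Data.Nat.Properties
  using (+-suc; ≤-trans; <⇒≱; m<n+m; m≤n+m; m≤n⇒m≤1+n; ≮⇒≥; <⇒≤; +-cancelˡ-≤; +-monoʳ-≤; +-mono-≤; ≤-reflexive; m≤n+o⇒m∸n≤o; *-identityʳ; module ≤-Reasoning)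
open import Data.Nat.Solver using (module +-*-Solver)
open import Data.Bool using (true; false)
open import Data.Bool.Properties using (¬-not) renaming (_≟_ to _≟ᵇ_)
open import Data.Fin as Fin using (zero; suc; combine; _≟_)
open import Data.Fin.Properties using (any?; pigeonhole; combine-injective)
open import Data.List using ([]; _∷_; [_]; _++_; map; filter)
open import Data.List.Properties using (length-map; length-++; ++-identityʳ; ++-assoc)
open import Data.List.Membership.Propositional.Properties using (∈-lookup; ∈-map⁺)
open import Data.List.Relation.Binary.Subset.Propositional.Properties
  using (filter-⊆; xs⊆xs++ys; xs⊆ys++xs; ++⁺ʳ; ⊆-trans)
open import Data.List.Relation.Binary.Permutation.Propositional
  using (_↭_; ↭-refl; ↭-prep; ↭-sym; ↭-trans; ↭⇒↭ₛ; module PermutationReasoning)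
open import Data.List.Relation.Binary.Permutation.Propositional.Properties
  using (All-resp-↭; ∈-resp-↭; ↭-length; ++-comm; ∷↭∷ʳ; filter-↭; ++-commutativeMonoid; ++⁺ˡ)
import Data.List.Relation.Binary.Permutation.Setoid.Properties as Permutationₛ
open import Data.List.Relation.Unary.All as All using ([]; _∷_)
open import Data.List.Relation.Unary.All.Properties using (all-filter; ¬Any⇒All¬)
import Data.List.Relation.Unary.All.Properties as All
open import Data.List.Relation.Unary.Any using (here; there)
open import Data.List.Relation.Unary.AllPairs using (AllPairs; []; _∷_)
import Data.List.Relation.Unary.AllPairs.Properties as AllPairs
import Data.List.Relation.Unary.Unique.Propositional.Properties as Unique
open import Data.List.Relation.Unary.Linked using (Linked; [-]; _∷_)
open import Data.Product using (∃₂; _,_; proj₁; proj₂)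
open import Data.Empty using (⊥)
open import Function using (_∘_)
open import Relation.Nullary using (¬_; yes; no; does; ¬?; contradiction)
open import Relation.Unary using (Decidable; _∩_)
open import Relation.Unary.Properties using (_∩?_)
open import Relation.Binary using (Symmetric)
open import Relation.Binary.PropositionalEquality as ≡
  using (_≡_; _≢_; refl; cong; cong₂; subst; subst₂; setoid)

module _ {A : Set} where

  Unique-resp-↭ : ∀ {xs ys : List A} → xs ↭ ys → Unique xs → Unique ys
  Unique-resp-↭ xs↭ys = Permutationₛ.Unique-resp-↭ (setoid A) (↭⇒↭ₛ xs↭ys)

  AllPairs-lookup : ∀ {R : A → A → Set} {xs} → AllPairs R xs →
                    ∀ {i j : Fin (length xs)} → i Fin.< j → R (lookup xs i) (lookup xs j)
  AllPairs-lookup (Rx ∷ _)   {zero}  {suc j} _         = All.lookup Rx (∈-lookup j)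
  AllPairs-lookup (_  ∷ Rxs) {suc i} {suc j} (s<s i<j) = AllPairs-lookup Rxs i<j

  tagged-length≤ : ∀ {m} (Tag : A → Fin m → Set) {Apart : A → A → Set} {xs} →
                   AllPairs Apart xs → All (λ x → ∃ (Tag x)) xs →
                   (∀ {x y ℓ} → x ∈ xs → y ∈ xs → Tag x ℓ → Tag y ℓ → ¬ Apart x y) →
                   length xs ≤ m
  tagged-length≤ Tag {xs = xs} apart tagged clash = ≮⇒≥ λ m<length →
    let i , j , i<j , same = pigeonhole m<length tag
    in clash (∈-lookup i) (∈-lookup j) (tag-of i) (subst (Tag _) (≡.sym same) (tag-of j))
             (AllPairs-lookup apart i<j)
    where
    tag : Fin (length xs) → Fin _
    tag i = proj₁ (All.lookup tagged (∈-lookup i))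
    tag-of : ∀ i → Tag (lookup xs i) (tag i)
    tag-of i = proj₂ (All.lookup tagged (∈-lookup i))

  module _ {P Q : A → Set} (P? : Decidable P) (Q? : Decidable Q) where

    length-filter-∩ : ∀ xs → length (filter P? xs) + length (filter Q? xs)
                             ≤ length xs + length (filter (P? ∩? Q?) xs)
    length-filter-∩ []       = z≤n
    length-filter-∩ (x ∷ xs) with ih ← length-filter-∩ xs | does (P? x) | does (Q? x)
    ... | true  | true  = s≤s (subst₂ _≤_ (≡.sym (+-suc _ _)) (≡.sym (+-suc _ _)) (s≤s ih))
    ... | true  | false = s≤s ih
    ... | false | true  = ≤-trans (≤-reflexive (+-suc _ _)) (s≤s ih)
    ... | false | false = m≤n⇒m≤1+n ih

  module _ {P : A → Set} (P? : Decidable P) where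

    length-filter-∁ : ∀ xs → length (filter (¬? ∘ P?) xs) + length (filter P? xs) ≡ length xs
    length-filter-∁ []       = refl
    length-filter-∁ (x ∷ xs) with ih ← length-filter-∁ xs | does (P? x)
    ... | true  = ≡.trans (+-suc _ _) (cong suc ih)
    ... | false = cong suc ih

    length-filter-map : ∀ {B : Set} (f : B → A) xs →
                        length (filter P? (map f xs)) ≡ length (filter (P? ∘ f) xs)
    length-filter-map f []       = refl
    length-filter-map f (x ∷ xs) with ih ← length-filter-map f xs | does (P? (f x))
    ... | true  = cong suc ih
    ... | false = ih

  ∈-tail : ∀ {x y : A} {xs} → x ≢ y → x ∈ y ∷ xs → x ∈ xs
  ∈-tail x≢y (here x≡y) = contradiction x≡y x≢y
  ∈-tail x≢y (there x∈xs) = x∈xs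

  consecutive : A → List A → List (A × A)
  consecutive u []       = []
  consecutive u (v ∷ vs) = (u , v) ∷ consecutive v vs

  map-proj₁-consecutive : ∀ u vs v → map proj₁ (consecutive u (vs ++ [ v ])) ≡ u ∷ vs
  map-proj₁-consecutive u []       v = refl
  map-proj₁-consecutive u (x ∷ vs) v = cong (u ∷_) (map-proj₁-consecutive x vs v)

  map-proj₂-consecutive : ∀ u vs → map proj₂ (consecutive u vs) ≡ vs
  map-proj₂-consecutive u []       = refl
  map-proj₂-consecutive u (v ∷ vs) = cong (v ∷_) (map-proj₂-consecutive v vs)

  concat-take-mono : ∀ {m n} (xss : List (List A)) → m ≤ n → concat (take m xss) ⊆ concat (take n xss)
  concat-take-mono {suc m} {suc n} (xs ∷ xss) (s≤s m≤n) = ++⁺ʳ xs (concat-take-mono xss m≤n)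

  lookup-⊆-concat-take : ∀ (xss : List (List A)) i → lookup xss i ⊆ concat (take (suc (toℕ i)) xss)
  lookup-⊆-concat-take (xs ∷ xss) zero    = xs⊆xs++ys xs []
  lookup-⊆-concat-take (xs ∷ xss) (suc i) = ⊆-trans (lookup-⊆-concat-take xss i) (xs⊆ys++xs _ xs)

t+a≡c⇒a+a≤c+d⇒c∸d≤2*t : ∀ {t a c d} → t + a ≡ c → a + a ≤ c + d → c ∸ d ≤ 2 * t
t+a≡c⇒a+a≤c+d⇒c∸d≤2*t {t} {a} {d = d} refl a+a≤c+d = m≤n+o⇒m∸n≤o (t + a) d (begin
  t + a        ≤⟨ +-monoʳ-≤ t a≤t+d ⟩
  t + (t + d)  ≡⟨ solve 2 (λ t d → t :+ (t :+ d) := d :+ con 2 :* t) refl t d ⟩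
  d + 2 * t    ∎)
  where
  open ≤-Reasoning
  open +-*-Solver
  a≤t+d : a ≤ t + d
  a≤t+d = +-cancelˡ-≤ a a (t + d) (≤-trans a+a≤c+d (≤-reflexive (solve 3 (λ t a d → (t :+ a) :+ d := a :+ (t :+ d)) refl t a d)))

module _ {A : Set} (E : A → A → Set) where

  infixr 5 _∷_

  data Walk : A → List A → A → Set where
    []  : ∀ {u} → Walk u [] u
    _∷_ : ∀ {u v vs w} → E u v → Walk v vs w → Walk u (v ∷ vs) w

  ClosedWalkThrough : List A → Set
  ClosedWalkThrough K = ∃₂ λ u vs → Walk u vs u × vs ↭ K

module _ {A : Set} {E : A → A → Set} where

  infixr 5 _++ʷ_

  _++ʷ_ : ∀ {u vs v ws w} → Walk E u vs v → Walk E v ws w → Walk E u (vs ++ ws) w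
  []      ++ʷ q = q
  (e ∷ p) ++ʷ q = e ∷ (p ++ʷ q)

  Walk⇒Linked : ∀ {u vs v} → Walk E u vs v → Linked E (u ∷ vs)
  Walk⇒Linked []      = [-]
  Walk⇒Linked (e ∷ p) = e ∷ Walk⇒Linked p

  Linked⇒Walk : ∀ {u} vs v → Linked E (u ∷ vs ++ [ v ]) → Walk E u (vs ++ [ v ]) v
  Linked⇒Walk []       v (e ∷ [-]) = e ∷ []
  Linked⇒Walk (x ∷ vs) v (e ∷ l)   = e ∷ Linked⇒Walk vs v l

  reverseʷ : Symmetric E → ∀ {u vs v} → Walk E u vs v → ∃[ vs′ ] (Walk E v vs′ u × u ∷ vs ↭ v ∷ vs′)
  reverseʷ E-sym []                    = [] , [] , ↭-refl
  reverseʷ E-sym {u} (e ∷ p) with vs′ , p′ , vs↭ ← reverseʷ E-sym p =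
    vs′ ++ [ u ] , p′ ++ʷ (E-sym e ∷ []) , ↭-trans (↭-prep u vs↭) (∷↭∷ʳ u _)

  consecutive-++ : ∀ {u vs v} → Walk E u vs v → ∀ ws → consecutive u (vs ++ ws) ≡ consecutive u vs ++ consecutive v ws
  consecutive-++ []      ws = refl
  consecutive-++ (_∷_ {v = x} e p) ws = cong ((_ , x) ∷_) (consecutive-++ p ws)

  split-at-step : ∀ {u vs v b b′} → Walk E u vs v → (b , b′) ∈ consecutive u vs →
                  ∃₂ λ vs₁ vs₂ → vs ≡ vs₁ ++ b′ ∷ vs₂ × Walk E u vs₁ b × E b b′ × Walk E b′ vs₂ v
  split-at-step (e ∷ p) (here refl) = [] , _ , refl , [] , e , p
  split-at-step (_∷_ {v = x} e p) (there step) with vs₁ , vs₂ , refl , p₁ , e′ , p₂ ← split-at-step p step =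
    x ∷ vs₁ , vs₂ , refl , e ∷ p₁ , e′ , p₂

  closedWalk⇒IsCycle : ∀ {u vs} → Walk E u vs u → Unique vs → 3 ≤ length vs → IsCycle E vs
  closedWalk⇒IsCycle (e ∷ p) unique long = long , unique , Walk⇒Linked (p ++ʷ (e ∷ []))

module CycleSurgery {A : Set} {E : A → A → Set} (E-sym : Symmetric E) {x L} (cycle : Walk E x L x) where

  open PermutationReasoning

  open-at : ∀ {a a′} → (a , a′) ∈ consecutive x L →
            ∃[ P ] (Walk E a′ P a × a′ ∷ P ↭ L × consecutive x L ↭ (a , a′) ∷ consecutive a′ P)
  open-at {a} {a′} step with L₁ , L₂ , refl , p₁ , _ , p₂ ← split-at-step cycle step =
    L₂ ++ L₁ , p₂ ++ʷ p₁ , ++-comm (a′ ∷ L₂) L₁ , steps↭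
    where
    open import Algebra.Solver.CommutativeMonoid (++-commutativeMonoid {A = A × A})
    steps↭ : consecutive x (L₁ ++ a′ ∷ L₂) ↭ (a , a′) ∷ consecutive a′ (L₂ ++ L₁)
    steps↭ = begin
      consecutive x (L₁ ++ a′ ∷ L₂)                       ≡⟨ consecutive-++ p₁ (a′ ∷ L₂) ⟩
      consecutive x L₁ ++ (a , a′) ∷ consecutive a′ L₂    ↭⟨ solve 3 (λ s₁ s s₂ → s₁ ⊕ (s ⊕ s₂) ⊜ s ⊕ (s₂ ⊕ s₁)) ↭-refl
                                                               (consecutive x L₁) [ a , a′ ] (consecutive a′ L₂) ⟩
      (a , a′) ∷ consecutive a′ L₂ ++ consecutive x L₁    ≡⟨ cong ((a , a′) ∷_) (consecutive-++ p₂ L₁) ⟨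
      (a , a′) ∷ consecutive a′ (L₂ ++ L₁)                ∎

  insert-vertex : ∀ {a a′ w} → (a , a′) ∈ consecutive x L → E a w → E w a′ → ClosedWalkThrough E (w ∷ L)
  insert-vertex {a′ = a′} {w} step aw wa′ with P , p , P↭L , _ ← open-at step =
    w , a′ ∷ P ++ [ w ] , wa′ ∷ (p ++ʷ (aw ∷ [])) , ↭-trans (↭-sym (∷↭∷ʳ w (a′ ∷ P))) (↭-prep w P↭L)

  insert-two-vertices : ∀ {a a′ b b′ w w′} → (a , a′) ∈ consecutive x L → (b , b′) ∈ consecutive x L → a ≢ b →
                        E b w → E w a → E b′ w′ → E w′ a′ → ClosedWalkThrough E (w ∷ w′ ∷ L)
  insert-two-vertices {a} {a′} {b} {b′} {w} {w′} stepA stepB a≢b bw wa b′w′ w′a′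
    with P , p , P↭L , steps↭ ← open-at stepA
    with P₁ , P₂ , refl , p₁ , _ , p₂ ← split-at-step p (∈-tail (a≢b ∘ ≡.sym ∘ cong proj₁) (∈-resp-↭ steps↭ stepB))
    with P₂ʳ , p₂ʳ , P₂↭ ← reverseʷ E-sym p₂ =
    a′ , P₁ ++ w ∷ a ∷ P₂ʳ ++ w′ ∷ a′ ∷ [] , p₁ ++ʷ (bw ∷ wa ∷ (p₂ʳ ++ʷ (b′w′ ∷ w′a′ ∷ []))) , vertices↭
    where
    open import Algebra.Solver.CommutativeMonoid (++-commutativeMonoid {A = A})
    vertices↭ : P₁ ++ w ∷ a ∷ P₂ʳ ++ w′ ∷ a′ ∷ [] ↭ w ∷ w′ ∷ L
    vertices↭ = begin
      P₁ ++ w ∷ a ∷ P₂ʳ ++ w′ ∷ a′ ∷ []  ↭⟨ solve 6 (λ p₁ w a p₂ w′ a′ → p₁ ⊕ (w ⊕ (a ⊕ (p₂ ⊕ (w′ ⊕ a′))))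
                                                                   ⊜ w ⊕ (w′ ⊕ (a′ ⊕ (p₁ ⊕ (a ⊕ p₂))))) ↭-refl
                                                   P₁ [ w ] [ a ] P₂ʳ [ w′ ] [ a′ ] ⟩
      w ∷ w′ ∷ a′ ∷ P₁ ++ a ∷ P₂ʳ         ↭⟨ ↭-prep w (↭-prep w′ (↭-prep a′ (++⁺ˡ P₁ (↭-sym P₂↭)))) ⟩
      w ∷ w′ ∷ a′ ∷ P₁ ++ b′ ∷ P₂         ↭⟨ ↭-prep w (↭-prep w′ P↭L) ⟩
      w ∷ w′ ∷ L                          ∎

module _ {N} {col : RedBlue N} where

  RedAdj-sym : SymmetricColouring col → Symmetric (RedAdj col)
  RedAdj-sym col-sym (u≢v , red) = u≢v ∘ ≡.sym , ≡.trans (col-sym _ _) red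

  closedWalk-length≤ : ∀ {S C K} → LongestRedCycleAvoiding col S C → ClosedWalkThrough (RedAdj col) K →
                       Unique K → All (_∉ S) K → 3 ≤ length K → length K ≤ length C
  closedWalk-length≤ (_ , longest) (_ , vs , walk , vs↭K) unique avoids long =
    subst (_≤ _) (↭-length vs↭K)
      (longest vs (closedWalk⇒IsCycle walk (Unique-resp-↭ K↭vs unique) (subst (3 ≤_) (≡.sym (↭-length vs↭K)) long)
                  , All-resp-↭ K↭vs avoids))
    where K↭vs = ↭-sym vs↭K

module LongestRedCycle {N Δ} {col : RedBlue N} (col-sym : SymmetricColouring col)
                       {S x xs} (longest : LongestRedCycleAvoiding col S (x ∷ xs))
                       (w : Fin Δ → Fin N) (w∉S : ∀ j → w j ∉ S) (w∉C : ∀ j → w j ∉ x ∷ xs) where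

  C L : List (Fin N)
  C = x ∷ xs
  L = xs ++ [ x ]

  L↭C : L ↭ C
  L↭C = ↭-sym (∷↭∷ʳ x xs)

  C-unique : Unique C
  C-unique = proj₁ (proj₂ (proj₁ (proj₁ longest)))

  cycle : Walk (RedAdj col) x L x
  cycle = Linked⇒Walk xs x (proj₂ (proj₂ (proj₁ (proj₁ longest))))

  open CycleSurgery (RedAdj-sym col-sym) cycle

  steps : List (Fin N × Fin N)
  steps = consecutive x L

  source∈C : ∀ {a a′} → (a , a′) ∈ steps → a ∈ C
  source∈C step = subst (_ ∈_) (map-proj₁-consecutive x xs x) (∈-map⁺ proj₁ step)

  target∈C : ∀ {a a′} → (a , a′) ∈ steps → a′ ∈ C
  target∈C step = ∈-resp-↭ L↭C (subst (_ ∈_) (map-proj₂-consecutive x L) (∈-map⁺ proj₂ step))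

  RedTo : Fin Δ → Fin N → Set
  RedTo j v = col (w j) v ≡ true

  Hit : Fin N → Set
  Hit v = ∃[ j ] RedTo j v

  Hit? : Decidable Hit
  Hit? v = any? (λ j → col (w j) v ≟ᵇ true)

  to-w : ∀ {j v} → v ∈ C → RedTo j v → RedAdj col v (w j)
  to-w {j} v∈C red = (λ v≡wj → w∉C j (subst (_∈ C) v≡wj v∈C)) , ≡.trans (col-sym _ _) red

  from-w : ∀ {j v} → v ∈ C → RedTo j v → RedAdj col (w j) v
  from-w v∈C = RedAdj-sym col-sym ∘ to-w v∈C

  cannot-extend : ∀ {ws} → ClosedWalkThrough (RedAdj col) (ws ++ L) → Unique (ws ++ C) → All (_∉ S) ws →
                  0 < length ws → ⊥
  cannot-extend {ws} (u , vs , walk , vs↭) unique avoids nonempty =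
    <⇒≱ (m<n+m (length C) nonempty)
      (subst (_≤ length C) (length-++ ws)
        (closedWalk-length≤ longest (u , vs , walk , ↭-trans vs↭ (++⁺ˡ ws L↭C)) unique
          (All.++⁺ avoids (proj₂ (proj₁ longest)))
          (≤-trans (proj₁ (proj₁ (proj₁ longest))) (subst (length C ≤_) (≡.sym (length-++ ws)) (m≤n+m _ _)))))

  doubly-hit-steps-coincide : ∀ {a a′ b b′ j j′} → (a , a′) ∈ steps → (b , b′) ∈ steps →
                              RedTo j a → RedTo j b → RedTo j′ a′ → RedTo j′ b′ → ¬ a ≢ b
  doubly-hit-steps-coincide {j = j} {j′} stepA stepB ja jb j′a′ j′b′ a≢b with w j ≟ w j′
  ... | yes wj≡wj′ =
    cannot-extend {[ w j ]}
      (insert-vertex stepA (to-w (source∈C stepA) ja)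
        (subst (λ u → RedAdj col u _) (≡.sym wj≡wj′) (from-w (target∈C stepA) j′a′)))
      (¬Any⇒All¬ C (w∉C j) ∷ C-unique) (w∉S j ∷ []) (s≤s z≤n)
  ... | no wj≢wj′ =
    cannot-extend {w j ∷ w j′ ∷ []}
      (insert-two-vertices stepA stepB a≢b
        (to-w (source∈C stepB) jb) (from-w (source∈C stepA) ja)
        (to-w (target∈C stepB) j′b′) (from-w (target∈C stepA) j′a′))
      ((wj≢wj′ ∷ ¬Any⇒All¬ C (w∉C j)) ∷ ¬Any⇒All¬ C (w∉C j′) ∷ C-unique) (w∉S j ∷ w∉S j′ ∷ []) (s≤s z≤n)

  DoublyHit? : Decidable ((Hit ∘ proj₁) ∩ (Hit ∘ proj₂))
  DoublyHit? = (Hit? ∘ proj₁) ∩? (Hit? ∘ proj₂)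

  Tag : Fin N × Fin N → Fin (Δ * Δ) → Set
  Tag (a , a′) ℓ = ∃₂ λ j j′ → ℓ ≡ combine j j′ × RedTo j a × RedTo j′ a′

  doubly-hit-steps≤ : length (filter DoublyHit? steps) ≤ Δ * Δ
  doubly-hit-steps≤ = tagged-length≤ Tag apart tagged same-tag
    where
    apart : AllPairs (λ s t → proj₁ s ≢ proj₁ t) (filter DoublyHit? steps)
    apart = AllPairs.filter⁺ DoublyHit?
              (AllPairs.map⁻ (subst Unique (≡.sym (map-proj₁-consecutive x xs x)) C-unique))
    tagged : All (λ s → ∃ (Tag s)) (filter DoublyHit? steps)
    tagged = All.map (λ { ((j , ja) , (j′ , j′a′)) → combine j j′ , j , j′ , refl , ja , j′a′ })
                     (all-filter DoublyHit? steps)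
    same-tag : ∀ {s t ℓ} → s ∈ filter DoublyHit? steps → t ∈ filter DoublyHit? steps →
               Tag s ℓ → Tag t ℓ → ¬ proj₁ s ≢ proj₁ t
    same-tag s∈ t∈ (j , j′ , refl , ja , j′a′) (k , k′ , same , kb , k′b′)
      with refl , refl ← combine-injective j j′ k k′ same =
      doubly-hit-steps-coincide (filter-⊆ DoublyHit? steps s∈) (filter-⊆ DoublyHit? steps t∈) ja kb j′a′ k′b′

  hits : ℕ
  hits = length (filter Hit? C)

  double-count : hits + hits ≤ length C + Δ * Δ
  double-count = begin
    hits + hits                                                        ≡⟨ cong₂ _+_ sources targets ⟨
    length (filter (Hit? ∘ proj₁) steps) + length (filter (Hit? ∘ proj₂) steps)
                                                                       ≤⟨ length-filter-∩ (Hit? ∘ proj₁) (Hit? ∘ proj₂) steps ⟩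
    length steps + length (filter DoublyHit? steps)                   ≤⟨ +-mono-≤ (≤-reflexive length-steps) doubly-hit-steps≤ ⟩
    length C + Δ * Δ                                                   ∎
    where
    open ≤-Reasoning
    sources : length (filter (Hit? ∘ proj₁) steps) ≡ hits
    sources = ≡.trans (≡.sym (length-filter-map Hit? proj₁ steps))
                      (cong (length ∘ filter Hit?) (map-proj₁-consecutive x xs x))
    targets : length (filter (Hit? ∘ proj₂) steps) ≡ hits
    targets = ≡.trans (≡.sym (length-filter-map Hit? proj₂ steps))
                      (≡.trans (cong (length ∘ filter Hit?) (map-proj₂-consecutive x L))
                               (↭-length (filter-↭ Hit? L↭C)))
    length-steps : length steps ≡ length C
    length-steps = ≡.trans (≡.sym (length-map proj₁ steps)) (cong length (map-proj₁-consecutive x xs x))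

  unhit : List (Fin N)
  unhit = filter (¬? ∘ Hit?) C

  unhit-blue : All (λ v → ∀ j → BlueAdj col (w j) v) unhit
  unhit-blue = All.tabulate λ {v} v∈unhit j →
      (λ wj≡v → w∉C j (subst (_∈ C) (≡.sym wj≡v) (filter-⊆ (¬? ∘ Hit?) C v∈unhit)))
    , ¬-not (λ red → All.lookup (all-filter (¬? ∘ Hit?) C) v∈unhit (j , red))

  many-unhit : length C ∸ Δ ^ 2 ≤ 2 * length unhit
  many-unhit = t+a≡c⇒a+a≤c+d⇒c∸d≤2*t {t = length unhit} (length-filter-∁ Hit? C)
                 (subst (λ d → hits + hits ≤ length C + d) (cong (Δ *_) (≡.sym (*-identityʳ Δ))) double-count)

blue-on-longest-cycle : ∀ {N Δ} {col : RedBlue N} → SymmetricColouring col → ∀ {S C} →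
  LongestRedCycleAvoiding col S C → (w : Fin Δ → Fin N) → (∀ j → w j ∉ S) → (∀ j → w j ∉ C) →
  ∃[ T ] (T ⊆ C × Unique T × All (λ v → ∀ j → BlueAdj col (w j) v) T × length C ∸ Δ ^ 2 ≤ 2 * length T)
blue-on-longest-cycle _ {C = []} ((() , _) , _)
blue-on-longest-cycle col-sym {C = _ ∷ _} longest w w∉S w∉C =
  unhit , filter-⊆ (¬? ∘ Hit?) C , Unique.filter⁺ (¬? ∘ Hit?) C-unique , unhit-blue , many-unhit
  where open LongestRedCycle col-sym longest w w∉S w∉C

mutual
  -- OrderedDisjointLongest is defined through a local function `go S Cs` that cannot be
  -- named; the metavariable Chain col X is solved to it by unification in chain-tail.
  Chain : ∀ {N} → RedBlue N → List (List (Fin N)) → List (Fin N) → List (List (Fin N)) → Set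
  Chain col X = _

  chain-tail : ∀ {N} (col : RedBlue N) C Cs → OrderedDisjointLongest col (C ∷ Cs) → Chain col (C ∷ Cs) C Cs
  chain-tail col C Cs ordered with C ∷ Cs | proj₂ ordered
  ... | _ | tail = tail

chain-lookup : ∀ {N} {col : RedBlue N} {X S} Cs → Chain col X S Cs → (i : Fin (length Cs)) →
               LongestRedCycleAvoiding col (S ++ concat (take (toℕ i) Cs)) (lookup Cs i)
chain-lookup {col = col} {S = S} (C ∷ Cs) (longest , _) zero =
  subst (λ T → LongestRedCycleAvoiding col T C) (≡.sym (++-identityʳ S)) longest
chain-lookup {col = col} {X} {S} (C ∷ Cs) (_ , chain) (suc i) =
  subst (λ T → LongestRedCycleAvoiding col T (lookup Cs i)) (++-assoc S C _)
        (chain-lookup {X = X} {S ++ C} Cs chain i)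

ordered-lookup : ∀ {N} {col : RedBlue N} {Cs} → OrderedDisjointLongest col Cs → (i : Fin (length Cs)) →
                 LongestRedCycleAvoiding col (concat (take (toℕ i) Cs)) (lookup Cs i)
ordered-lookup {Cs = C ∷ Cs} (longest , _) zero    = longest
ordered-lookup {col = col} {C ∷ Cs} ordered (suc i) = chain-lookup {X = C ∷ Cs} {C} Cs (chain-tail col C Cs ordered) i

lemma5 : (Δ : ℕ) → 3 ≤ Δ →
    (ε : ℚ) → 0ℚ ℚ.< ε → ε ℚ.* ℕ→ℚ (Δ ^ 5) ℚ.≤ 1ℚ →
    ∃[ n₀ ] ∀ (n : ℕ) → n₀ ≤ n →
      (G : SimpleGraph n) → MaxDegree≤ G Δ →
      (k σ : ℕ) → IsChromaticNumber G k → IsSigma G k σ →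
      let N = (k ∸ 1) * n + σ + ⌈ ℕ→ℚ (Δ ^ 4) ℚ.* ε ℚ.* ℕ→ℚ n ⌉ℕ in
      (col : RedBlue N) → SymmetricColouring col →
      (Cs : List (List (Fin N))) → OrderedDisjointLongest col Cs →
      (r : ℕ) → IsLargestIndexAbove (ε ℚ.* ε ℚ.* ℕ→ℚ n) Cs r →
      (w : Fin Δ → Fin N) → (∀ j → w j ∉ concat (take r Cs)) →
      (i : Fin (length Cs)) → toℕ i < r →
      ∃[ S ] (S ⊆ lookup Cs i × Unique S × All (λ v → ∀ j → BlueAdj col (w j) v) S
              × length (lookup Cs i) ∸ Δ ^ 2 ≤ 2 * length S)
lemma5 _ _ _ _ _ = 0 , λ _ _ _ _ _ _ _ _ _ col-sym Cs ordered _ _ w w∉W i i<r →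
  blue-on-longest-cycle col-sym (ordered-lookup ordered i) w
    (λ j → w∉W j ∘ concat-take-mono Cs (<⇒≤ i<r))
    (λ j → w∉W j ∘ concat-take-mono Cs i<r ∘ lookup-⊆-concat-take Cs i)
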